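{- Let $\Phi_B$ and $\Phi_C$ be the root systems of types $B_n$ and $C_n$ in the same vector space $V=\mathbb R^n$, with common Weyl group $W$, and let $w\in W$. If $(w,\Phi_C)$ avoids the type $A_3$ patterns $3142$, $2413$ and the two type $B_2$ patterns of length two, then so does $(w,\Phi_B)$.
   Context: Type $B_n$: $\Phi_B=\{\pm e_i\pm e_j,\pm e_i\}$, positive roots $e_i\pm e_j$ ($i<j$), $e_i$. Type $C_n$: $\Phi_C=\{\pm e_i\pm e_j,\pm 2e_i\}$, positive roots $e_i\pm e_j$ ($i<j$), $2e_i$. Both have the same Weyl group $W\subseteq GL(V)$ (signed permutations). For a root system $\Psi$ with positive roots $\Psi^+$, $I_\Psi(w)=\{\alpha\in\Psi^+:w\alpha\in-\Psi^+\}$. A subsystem is $\Psi\cap U$ for a subspace $U\subseteq V$, with positive roots $\Psi^+\cap U$. $(w,\Psi)$ contains $3142$ (resp. $2413$) if for some $U$, $\Psi\cap U$ is of type $A_3$ with simple roots $a_1,a_2,a_3$ ($a_1\perp a_3$) and $I_\Psi(w)\cap U=\{a_1,a_3,a_1+a_2+a_3\}$ (resp. $\{a_2,a_1+a_2,a_2+a_3\}$); it contains a type $B_2$ pattern of length two if for some $U$, $\Psi\cap U$ is of type $B_2$ with simple roots $b_1$ (long), $b_2$ (short), positive roots $b_1,b_2,b_1+b_2,b_1+2b_2$, and $I_\Psi(w)\cap U$ is $\{b_1,b_1+b_2\}$ or $\{b_2,b_1+2b_2\}$. Avoiding means not containing. -}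

module Defs where

open import Data.Nat using (ℕ)
open import Data.Integer using (ℤ; +_; -_; _+_; _*_; _-_)
open import Data.Fin using (Fin; _<_; _≟_)
open import Data.Fin.Permutation using (Permutation′; _⟨$⟩ˡ_)
open import Data.Bool using (Bool; true; false; if_then_else_)
open import Data.Vec using (Vec; tabulate; lookup; zipWith; map; foldr)
open import Data.Product using (_×_; ∃; ∃-syntax; _,_)
open import Data.Sum using (_⊎_)
open import Relation.Binary.PropositionalEquality using (_≡_; _≢_)
open import Relation.Nullary using (¬_; does)
open import Function.Bundles using (_⇔_)

-- Vectors of V = ℝⁿ with integer coordinates (all roots of B_n, C_n lie in ℤⁿ).
Vect : ℕ → Set
Vect n = Vec ℤ n

infixl 6 _⊕_ _⊖_
infixl 7 _⊙_

_⊕_ : ∀ {n} → Vect n → Vect n → Vect n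
_⊕_ = zipWith _+_

_⊖_ : ∀ {n} → Vect n → Vect n → Vect n
_⊖_ = zipWith _-_

_⊙_ : ∀ {n} → ℤ → Vect n → Vect n
c ⊙ v = map (c *_) v

neg : ∀ {n} → Vect n → Vect n
neg = map (λ x → - x)

⟪_,_⟫ : ∀ {n} → Vect n → Vect n → ℤ
⟪ u , v ⟫ = foldr _ _+_ (+ 0) (zipWith _*_ u v)

e : ∀ {n} → Fin n → Vect n
e i = tabulate (λ k → if does (k ≟ i) then + 1 else + 0)

-- The Weyl group W of B_n / C_n: signed permutations.
-- w = (σ , ε) acts by  w(e_i) = (-1)^{ε i} e_{σ i}.

record SignedPerm (n : ℕ) : Set where
  constructor signedPerm
  field
    perm : Permutation′ n
    flip : Fin n → Bool      -- true means the sign -1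

sgn : Bool → ℤ
sgn true  = - (+ 1)
sgn false = + 1

act : ∀ {n} → SignedPerm n → Vect n → Vect n
act (signedPerm σ ε) v = tabulate (λ k → sgn (ε (σ ⟨$⟩ˡ k)) * lookup v (σ ⟨$⟩ˡ k))

data Type : Set where
  B C : Type

Pos : ∀ {n} → Type → Vect n → Set
Pos {n} B v = (∃[ i ] ∃[ j ] (i < j × (v ≡ e i ⊖ e j ⊎ v ≡ e i ⊕ e j)))
            ⊎ (∃[ i ] v ≡ e i)
Pos {n} C v = (∃[ i ] ∃[ j ] (i < j × (v ≡ e i ⊖ e j ⊎ v ≡ e i ⊕ e j)))
            ⊎ (∃[ i ] v ≡ (+ 2) ⊙ e i)

Inv : ∀ {n} → Type → SignedPerm n → Vect n → Set
Inv Ψ w α = Pos Ψ α × Pos Ψ (neg (act w α))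

-- Linear spans (over ℝ; for integer vectors equivalently over ℚ):
-- β ∈ span(a₁,…,a_k)  iff  d·β = Σ cᵢ aᵢ for integers cᵢ and d ≠ 0.

InSpan2 : ∀ {n} → Vect n → Vect n → Vect n → Set
InSpan2 a₁ a₂ β = ∃[ d ] ∃[ c₁ ] ∃[ c₂ ] (d ≢ + 0 × d ⊙ β ≡ c₁ ⊙ a₁ ⊕ c₂ ⊙ a₂)

InSpan3 : ∀ {n} → Vect n → Vect n → Vect n → Vect n → Set
InSpan3 a₁ a₂ a₃ β =
  ∃[ d ] ∃[ c₁ ] ∃[ c₂ ] ∃[ c₃ ] (d ≢ + 0 × d ⊙ β ≡ c₁ ⊙ a₁ ⊕ c₂ ⊙ a₂ ⊕ c₃ ⊙ a₃)

-- Subsystem Ψ ∩ U, U = span of the simple roots, of type A₃ with simple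
-- roots a₁ a₂ a₃ (a₁ ⊥ a₃): Cartan matrix of A₃ and positive roots
-- Ψ⁺ ∩ U = {a₁, a₂, a₃, a₁+a₂, a₂+a₃, a₁+a₂+a₃}.

A3Roots : ∀ {n} → Vect n → Vect n → Vect n → Vect n → Set
A3Roots a₁ a₂ a₃ β =
  β ≡ a₁ ⊎ β ≡ a₂ ⊎ β ≡ a₃ ⊎ β ≡ a₁ ⊕ a₂ ⊎ β ≡ a₂ ⊕ a₃ ⊎ β ≡ a₁ ⊕ a₂ ⊕ a₃

IsA3 : ∀ {n} → Type → Vect n → Vect n → Vect n → Set
IsA3 Ψ a₁ a₂ a₃ =
  ⟪ a₁ , a₃ ⟫ ≡ + 0 ×
  (+ 2) * ⟪ a₁ , a₂ ⟫ ≡ - ⟪ a₁ , a₁ ⟫ ×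
  (+ 2) * ⟪ a₁ , a₂ ⟫ ≡ - ⟪ a₂ , a₂ ⟫ ×
  (+ 2) * ⟪ a₂ , a₃ ⟫ ≡ - ⟪ a₂ , a₂ ⟫ ×
  (+ 2) * ⟪ a₂ , a₃ ⟫ ≡ - ⟪ a₃ , a₃ ⟫ ×
  (∀ β → InSpan3 a₁ a₂ a₃ β → (Pos Ψ β ⇔ A3Roots a₁ a₂ a₃ β))

-- Subsystem of type B₂ with simple roots b₁ (long), b₂ (short):
-- Cartan matrix of B₂ and Ψ⁺ ∩ U = {b₁, b₂, b₁+b₂, b₁+2b₂}.
IsB2 : ∀ {n} → Type → Vect n → Vect n → Set
IsB2 Ψ b₁ b₂ =
  ⟪ b₁ , b₁ ⟫ ≡ (+ 2) * ⟪ b₂ , b₂ ⟫ ×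
  ⟪ b₁ , b₂ ⟫ ≡ - ⟪ b₂ , b₂ ⟫ ×
  (∀ β → InSpan2 b₁ b₂ β →
     (Pos Ψ β ⇔ (β ≡ b₁ ⊎ β ≡ b₂ ⊎ β ≡ b₁ ⊕ b₂ ⊎ β ≡ b₁ ⊕ (+ 2) ⊙ b₂)))

Contains3142 : ∀ {n} → SignedPerm n → Type → Set
Contains3142 {n} w Ψ = ∃[ a₁ ] ∃[ a₂ ] ∃[ a₃ ] (IsA3 Ψ a₁ a₂ a₃ ×
  (∀ (β : Vect n) → InSpan3 a₁ a₂ a₃ β →
     (Inv Ψ w β ⇔ (β ≡ a₁ ⊎ β ≡ a₃ ⊎ β ≡ a₁ ⊕ a₂ ⊕ a₃))))

Contains2413 : ∀ {n} → SignedPerm n → Type → Set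
Contains2413 {n} w Ψ = ∃[ a₁ ] ∃[ a₂ ] ∃[ a₃ ] (IsA3 Ψ a₁ a₂ a₃ ×
  (∀ (β : Vect n) → InSpan3 a₁ a₂ a₃ β →
     (Inv Ψ w β ⇔ (β ≡ a₂ ⊎ β ≡ a₁ ⊕ a₂ ⊎ β ≡ a₂ ⊕ a₃))))

ContainsB2len2 : ∀ {n} → SignedPerm n → Type → Set
ContainsB2len2 {n} w Ψ = ∃[ b₁ ] ∃[ b₂ ] (IsB2 Ψ b₁ b₂ ×
  ((∀ (β : Vect n) → InSpan2 b₁ b₂ β → (Inv Ψ w β ⇔ (β ≡ b₁ ⊎ β ≡ b₁ ⊕ b₂)))
   ⊎
   (∀ (β : Vect n) → InSpan2 b₁ b₂ β →
      (Inv Ψ w β ⇔ (β ≡ b₂ ⊎ β ≡ b₁ ⊕ (+ 2) ⊙ b₂)))))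

AvoidsAll : ∀ {n} → SignedPerm n → Type → Set
AvoidsAll w Ψ = ¬ Contains3142 w Ψ × ¬ Contains2413 w Ψ × ¬ ContainsB2len2 w Ψ

module Submission where

-- After normalising lengths, Φ_B has short roots eᵢ (norm 1)
-- and long roots eᵢ ± eⱼ (norm 2), while Φ_C consists of the same roots
-- eᵢ ± eⱼ together with 2eᵢ.  Thus Φ_C is the dual root system of Φ_B:
-- the coroot map  v ↦ 2v/‖v‖²  fixes long roots, doubles short ones and
-- is a bijection Φ_B⁺ → Φ_C⁺.  As W consists of isometries it commutes
-- with this map, so v ∈ I_B(w) iff its coroot lies in I_C(w).
--
-- A pattern of (w, Φ_B) is then turned into the
-- same pattern of (w, Φ_C):
--   * an A₃ subsystem of Φ_B has all roots of the same even norm, hence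
--     consists of long roots, and is literally an A₃ subsystem of Φ_C
--     with the same inversions;
--   * a B₂ subsystem with simple roots b₁ (long), b₂ (short) is sent to
--     the B₂ subsystem of Φ_C with simple roots 2b₂ (long), b₁ (short);
--     the two length-two patterns are exchanged.
-- Contrapositively, avoiding all patterns in Φ_C implies it in Φ_B.

open import Defs
open import Data.Nat using (ℕ; suc)
import Data.Nat.Properties as ℕ
open import Data.Integer using (ℤ; +_; -_; _+_; _*_; _-_; ∣_∣)
import Data.Integer.Properties as ℤ
open import Data.Integer.Tactic.RingSolver using (solve-∀)
open import Data.Fin using (Fin; _<_) renaming (zero to fzero; suc to fsuc)
open import Data.Fin.Properties using (<⇒≢)
open import Data.Fin.Permutation using (_⟨$⟩ˡ_) renaming (flip to inverse)
open import Data.Vec using ([]; _∷_; tabulate; lookup; map)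
import Data.Vec.Properties as Vec
open import Data.Bool using (true; false)
open import Data.Product using (∃-syntax; _×_; _,_; proj₁; proj₂)
open import Data.Sum using (_⊎_; inj₁; inj₂)
import Data.Sum as Sum
open import Function using (_∘_)
open import Function.Bundles using (_⇔_; mk⇔; Equivalence)
import Function.Properties.Equivalence as ⇔
open import Relation.Nullary using (contradiction)
open import Relation.Binary.PropositionalEquality
open import Algebra.Properties.CommutativeMonoid.Sum ℤ.+-0-commutativeMonoid
  using (sum; sum-permute; sum-cong-≗)

open Equivalence using (to; from)

private
  variable
    n : ℕ

⊕-comm : (u v : Vect n) → u ⊕ v ≡ v ⊕ u
⊕-comm = Vec.zipWith-comm ℤ.+-comm

⊙-identity : (v : Vect n) → (+ 1) ⊙ v ≡ v
⊙-identity v = trans (Vec.map-cong ℤ.*-identityˡ v) (Vec.map-id v)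

⊙-assoc : ∀ a b (v : Vect n) → (a * b) ⊙ v ≡ a ⊙ (b ⊙ v)
⊙-assoc a b v = trans (Vec.map-cong (ℤ.*-assoc a b) v) (Vec.map-∘ (a *_) (b *_) v)

neg-⊙ : ∀ c (v : Vect n) → neg (c ⊙ v) ≡ c ⊙ neg v
neg-⊙ c v = begin
  map -_ (map (c *_) v)  ≡⟨ Vec.map-∘ -_ (c *_) v ⟨
  map (-_ ∘ (c *_)) v    ≡⟨ Vec.map-cong (ℤ.neg-distribʳ-* c) v ⟩
  map ((c *_) ∘ -_) v    ≡⟨ Vec.map-∘ (c *_) -_ v ⟩
  map (c *_) (map -_ v)  ∎
  where open ≡-Reasoning

⊙-distrib-⊕ : ∀ c (u v : Vect n) → c ⊙ (u ⊕ v) ≡ c ⊙ u ⊕ c ⊙ v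
⊙-distrib-⊕ c [] [] = refl
⊙-distrib-⊕ c (a ∷ u) (b ∷ v) = cong₂ _∷_ (ℤ.*-distribˡ-+ c a b) (⊙-distrib-⊕ c u v)

⊕-zero-multipleʳ : (u v : Vect n) → u ⊕ (+ 0) ⊙ v ≡ u
⊕-zero-multipleʳ [] [] = refl
⊕-zero-multipleʳ (a ∷ u) (b ∷ v) = cong₂ _∷_ (ℤ.+-identityʳ a) (⊕-zero-multipleʳ u v)

⊕-zero-multipleˡ : (u v : Vect n) → (+ 0) ⊙ u ⊕ v ≡ v
⊕-zero-multipleˡ [] [] = refl
⊕-zero-multipleˡ (a ∷ u) (b ∷ v) = cong₂ _∷_ (ℤ.+-identityˡ b) (⊕-zero-multipleˡ u v)

2⊙-injective : (u v : Vect n) → (+ 2) ⊙ u ≡ (+ 2) ⊙ v → u ≡ v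
2⊙-injective [] [] eq = refl
2⊙-injective (a ∷ u) (b ∷ v) eq = cong₂ _∷_
  (ℤ.*-cancelˡ-≡ (+ 2) a b (Vec.∷-injectiveˡ eq)) (2⊙-injective u v (Vec.∷-injectiveʳ eq))

‖_‖² : Vect n → ℤ
‖ v ‖² = ⟪ v , v ⟫

⟪⟫-comm : (u v : Vect n) → ⟪ u , v ⟫ ≡ ⟪ v , u ⟫
⟪⟫-comm [] [] = refl
⟪⟫-comm (a ∷ u) (b ∷ v) = cong₂ _+_ (ℤ.*-comm a b) (⟪⟫-comm u v)

⟪⟫-⊕ˡ : (u v w : Vect n) → ⟪ u ⊕ v , w ⟫ ≡ ⟪ u , w ⟫ + ⟪ v , w ⟫
⟪⟫-⊕ˡ [] [] [] = refl
⟪⟫-⊕ˡ (a ∷ u) (b ∷ v) (c ∷ w) rewrite ⟪⟫-⊕ˡ u v w = shuffle a b c ⟪ u , w ⟫ ⟪ v , w ⟫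
  where shuffle : ∀ a b c x y → (a + b) * c + (x + y) ≡ (a * c + x) + (b * c + y)
        shuffle = solve-∀

⟪⟫-⊙ˡ : ∀ c (u w : Vect n) → ⟪ c ⊙ u , w ⟫ ≡ c * ⟪ u , w ⟫
⟪⟫-⊙ˡ c [] [] = sym (ℤ.*-zeroʳ c)
⟪⟫-⊙ˡ c (a ∷ u) (b ∷ w) rewrite ⟪⟫-⊙ˡ c u w = factor c a b ⟪ u , w ⟫
  where factor : ∀ c a b x → c * a * b + c * x ≡ c * (a * b + x)
        factor = solve-∀

⟪⟫-⊙ʳ : ∀ c (u w : Vect n) → ⟪ w , c ⊙ u ⟫ ≡ c * ⟪ w , u ⟫
⟪⟫-⊙ʳ c u w = trans (⟪⟫-comm w (c ⊙ u)) (trans (⟪⟫-⊙ˡ c u w) (cong (c *_) (⟪⟫-comm u w)))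

‖⊕‖² : (u v : Vect n) → ‖ u ⊕ v ‖² ≡ ‖ u ‖² + (+ 2) * ⟪ u , v ⟫ + ‖ v ‖²
‖⊕‖² [] [] = refl
‖⊕‖² (a ∷ u) (b ∷ v) rewrite ‖⊕‖² u v = expand a b ‖ u ‖² ⟪ u , v ⟫ ‖ v ‖²
  where expand : ∀ a b x y z → (a + b) * (a + b) + (x + + 2 * y + z)
                             ≡ a * a + x + + 2 * (a * b + y) + (b * b + z)
        expand = solve-∀

‖⊖‖² : (u v : Vect n) → ‖ u ⊖ v ‖² ≡ ‖ u ‖² - (+ 2) * ⟪ u , v ⟫ + ‖ v ‖²
‖⊖‖² [] [] = refl
‖⊖‖² (a ∷ u) (b ∷ v) rewrite ‖⊖‖² u v = expand a b ‖ u ‖² ⟪ u , v ⟫ ‖ v ‖²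
  where expand : ∀ a b x y z → (a - b) * (a - b) + (x - + 2 * y + z)
                             ≡ a * a + x - + 2 * (a * b + y) + (b * b + z)
        expand = solve-∀

‖⊙‖² : ∀ c (v : Vect n) → ‖ c ⊙ v ‖² ≡ c * c * ‖ v ‖²
‖⊙‖² c [] = sym (ℤ.*-zeroʳ (c * c))
‖⊙‖² c (a ∷ v) rewrite ‖⊙‖² c v = factor c a ‖ v ‖²
  where factor : ∀ c a x → c * a * (c * a) + c * c * x ≡ c * c * (a * a + x)
        factor = solve-∀

‖⊕‖²-reflection : (u v : Vect n) → (+ 2) * ⟪ u , v ⟫ ≡ - ‖ v ‖² → ‖ u ⊕ v ‖² ≡ ‖ u ‖²
‖⊕‖²-reflection u v h = begin
  ‖ u ⊕ v ‖²                             ≡⟨ ‖⊕‖² u v ⟩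
  ‖ u ‖² + (+ 2) * ⟪ u , v ⟫ + ‖ v ‖²   ≡⟨ cong (λ t → ‖ u ‖² + t + ‖ v ‖²) h ⟩
  ‖ u ‖² + - ‖ v ‖² + ‖ v ‖²            ≡⟨ cancel ‖ u ‖² ‖ v ‖² ⟩
  ‖ u ‖²                                 ∎
  where open ≡-Reasoning
        cancel : ∀ a b → a + - b + b ≡ a
        cancel = solve-∀

zeroVec : ∀ n → Vect n
zeroVec n = tabulate (λ _ → + 0)

⟪zero,_⟫ : (v : Vect n) → ⟪ zeroVec n , v ⟫ ≡ + 0
⟪zero, [] ⟫ = refl
⟪zero, a ∷ v ⟫ = trans (ℤ.+-identityˡ _) ⟪zero, v ⟫

⟪e,e⟫ : (i : Fin n) → ⟪ e i , e i ⟫ ≡ + 1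
⟪e,e⟫ {suc n} fzero = cong (_+_ (+ 1)) ⟪zero, zeroVec n ⟫
⟪e,e⟫ {suc n} (fsuc i) = trans (ℤ.+-identityˡ _) (⟪e,e⟫ i)

⟪e,e⟫-orth : (i j : Fin n) → i ≢ j → ⟪ e i , e j ⟫ ≡ + 0
⟪e,e⟫-orth fzero fzero i≢j = contradiction refl i≢j
⟪e,e⟫-orth fzero (fsuc j) i≢j = trans (ℤ.+-identityˡ _) ⟪zero, e j ⟫
⟪e,e⟫-orth (fsuc i) fzero i≢j = trans (ℤ.+-identityˡ _) (trans (⟪⟫-comm (e i) _) ⟪zero, e i ⟫)
⟪e,e⟫-orth (fsuc i) (fsuc j) i≢j = trans (ℤ.+-identityˡ _) (⟪e,e⟫-orth i j (i≢j ∘ cong fsuc))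

-- the norm as a finite sum, so that invariance under permutations applies
‖‖²-as-sum : (v : Vect n) → ‖ v ‖² ≡ sum (λ k → lookup v k * lookup v k)
‖‖²-as-sum [] = refl
‖‖²-as-sum (a ∷ v) = cong (_+_ (a * a)) (‖‖²-as-sum v)

sgn-square : ∀ b x → sgn b * x * (sgn b * x) ≡ x * x
sgn-square true = solve-∀
sgn-square false = solve-∀

‖act‖² : (w : SignedPerm n) (v : Vect n) → ‖ act w v ‖² ≡ ‖ v ‖²
‖act‖² {n} (signedPerm σ ε) v = begin
  ‖ tabulate g ‖²
    ≡⟨ ‖‖²-as-sum (tabulate g) ⟩
  sum (λ k → lookup (tabulate g) k * lookup (tabulate g) k)
    ≡⟨ sum-cong-≗ (λ k → trans (cong₂ _*_ (Vec.lookup∘tabulate g k) (Vec.lookup∘tabulate g k))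
                                (sgn-square (ε (σ ⟨$⟩ˡ k)) (lookup v (σ ⟨$⟩ˡ k)))) ⟩
  sum (λ k → lookup v (σ ⟨$⟩ˡ k) * lookup v (σ ⟨$⟩ˡ k))
    ≡⟨ sum-permute (λ j → lookup v j * lookup v j) (inverse σ) ⟨
  sum (λ k → lookup v k * lookup v k)
    ≡⟨ ‖‖²-as-sum v ⟨
  ‖ v ‖² ∎
  where open ≡-Reasoning
        g : Fin n → ℤ
        g k = sgn (ε (σ ⟨$⟩ˡ k)) * lookup v (σ ⟨$⟩ˡ k)

‖neg‖² : (v : Vect n) → ‖ neg v ‖² ≡ ‖ v ‖²
‖neg‖² [] = refl
‖neg‖² (a ∷ v) = cong₂ _+_ (square a) (‖neg‖² v)
  where square : ∀ a → - a * - a ≡ a * a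
        square = solve-∀

act-⊙ : (w : SignedPerm n) (c : ℤ) (v : Vect n) → act w (c ⊙ v) ≡ c ⊙ act w v
act-⊙ (signedPerm σ ε) c v = trans
  (Vec.tabulate-cong (λ k → trans
     (cong (sgn (ε (σ ⟨$⟩ˡ k)) *_) (Vec.lookup-map (σ ⟨$⟩ˡ k) (c *_) v))
     (swap (sgn (ε (σ ⟨$⟩ˡ k))) c (lookup v (σ ⟨$⟩ˡ k)))))
  (Vec.tabulate-∘ (c *_) (λ k → sgn (ε (σ ⟨$⟩ˡ k)) * lookup v (σ ⟨$⟩ˡ k)))
  where swap : ∀ s c x → s * (c * x) ≡ c * (s * x)
        swap = solve-∀

‖neg-act‖² : (w : SignedPerm n) (v : Vect n) → ‖ neg (act w v) ‖² ≡ ‖ v ‖²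
‖neg-act‖² w v = trans (‖neg‖² (act w v)) (‖act‖² w v)

neg-act-⊙ : (w : SignedPerm n) (c : ℤ) (v : Vect n) → neg (act w (c ⊙ v)) ≡ c ⊙ neg (act w v)
neg-act-⊙ w c v = trans (cong neg (act-⊙ w c v)) (neg-⊙ c (act w v))

Common : Vect n → Set
Common {n} v = ∃[ i ] ∃[ j ] (i < j × (v ≡ e i ⊖ e j ⊎ v ≡ e i ⊕ e j))

‖common‖² : {v : Vect n} → Common v → ‖ v ‖² ≡ + 2
‖common‖² (i , j , i<j , inj₁ refl)
  rewrite ‖⊖‖² (e i) (e j) | ⟪e,e⟫ i | ⟪e,e⟫ j | ⟪e,e⟫-orth i j (<⇒≢ i<j) = refl
‖common‖² (i , j , i<j , inj₂ refl)
  rewrite ‖⊕‖² (e i) (e j) | ⟪e,e⟫ i | ⟪e,e⟫ j | ⟪e,e⟫-orth i j (<⇒≢ i<j) = refl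

‖2e‖² : (k : Fin n) → ‖ (+ 2) ⊙ e k ‖² ≡ + 4
‖2e‖² k rewrite ‖⊙‖² (+ 2) (e k) | ⟪e,e⟫ k = refl

posB-norm : {v : Vect n} → Pos B v → ‖ v ‖² ≡ + 1 ⊎ ‖ v ‖² ≡ + 2
posB-norm (inj₁ c) = inj₂ (‖common‖² c)
posB-norm (inj₂ (k , refl)) = inj₁ (⟪e,e⟫ k)

-- "u is the coroot of v": long vectors are their own coroots, short
-- vectors are doubled.  It maps Φ_B⁺ bijectively onto Φ_C⁺.
data Coroot {n} (v u : Vect n) : Set where
  long  : ‖ v ‖² ≡ + 2 → u ≡ v → Coroot v u
  short : ‖ v ‖² ≡ + 1 → u ≡ (+ 2) ⊙ v → Coroot v u

coroot-unique : {v u u′ : Vect n} → Coroot v u → Coroot v u′ → u ≡ u′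
coroot-unique (long _ p) (long _ q) = trans p (sym q)
coroot-unique (short _ p) (short _ q) = trans p (sym q)
coroot-unique (long l _) (short s _) = contradiction (trans (sym l) s) λ ()
coroot-unique (short s _) (long l _) = contradiction (trans (sym l) s) λ ()

posB→posC : {v u : Vect n} → Coroot v u → Pos B v → Pos C u
posB→posC (long _ refl) (inj₁ c) = inj₁ c
posB→posC (long l refl) (inj₂ (k , refl)) = contradiction (trans (sym (⟪e,e⟫ k)) l) λ ()
posB→posC (short s refl) (inj₁ c) = contradiction (trans (sym (‖common‖² c)) s) λ ()
posB→posC (short _ refl) (inj₂ (k , refl)) = inj₂ (k , refl)

posC→posB : {v u : Vect n} → Coroot v u → Pos C u → Pos B v
posC→posB (long _ refl) (inj₁ c) = inj₁ c
posC→posB (long l refl) (inj₂ (k , refl)) = contradiction (trans (sym (‖2e‖² k)) l) λ ()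
posC→posB {v = v} (short s refl) (inj₁ c) =
  contradiction (trans (sym (‖common‖² c)) (trans (‖⊙‖² (+ 2) v) (cong (+ 4 *_) s))) λ ()
posC→posB (short _ refl) (inj₂ (k , 2v≡2eₖ)) = inj₂ (k , 2⊙-injective _ (e k) 2v≡2eₖ)

coroot-pos : {v u : Vect n} → Coroot v u → Pos B v ⇔ Pos C u
coroot-pos cr = mk⇔ (posB→posC cr) (posC→posB cr)

-- w is an isometry and linear, so it commutes with taking coroots
coroot-neg-act : (w : SignedPerm n) {v u : Vect n} →
                 Coroot v u → Coroot (neg (act w v)) (neg (act w u))
coroot-neg-act w {v} (long l refl) = long (trans (‖neg-act‖² w v) l) refl
coroot-neg-act w {v} (short s refl) = short (trans (‖neg-act‖² w v) s) (neg-act-⊙ w (+ 2) v)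

coroot-inv : (w : SignedPerm n) {v u : Vect n} → Coroot v u → Inv B w v ⇔ Inv C w u
coroot-inv w cr = mk⇔
  (λ (p , q) → to (coroot-pos cr) p , to (coroot-pos (coroot-neg-act w cr)) q)
  (λ (p , q) → from (coroot-pos cr) p , from (coroot-pos (coroot-neg-act w cr)) q)

posC-coroot : {u : Vect n} → Pos C u → ∃[ v ] (Pos B v × Coroot v u)
posC-coroot (inj₁ c) = _ , inj₁ c , long (‖common‖² c) refl
posC-coroot (inj₂ (k , refl)) = e k , inj₂ (k , refl) , short (⟪e,e⟫ k) refl

d*2≢0 : ∀ d → d ≢ + 0 → d * + 2 ≢ + 0
d*2≢0 d d≢0 eq = d≢0 (ℤ.*-cancelʳ-≡ d (+ 0) (+ 2) eq)

coroot-span2 : {a₁ a₂ v u : Vect n} → Coroot v u → InSpan2 a₁ a₂ u → InSpan2 a₁ a₂ v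
coroot-span2 (long _ refl) s = s
coroot-span2 {v = v} (short _ refl) (d , c₁ , c₂ , d≢0 , eq) =
  d * + 2 , c₁ , c₂ , d*2≢0 d d≢0 , trans (⊙-assoc d (+ 2) v) eq

coroot-span3 : {a₁ a₂ a₃ v u : Vect n} → Coroot v u → InSpan3 a₁ a₂ a₃ u → InSpan3 a₁ a₂ a₃ v
coroot-span3 (long _ refl) s = s
coroot-span3 {v = v} (short _ refl) (d , c₁ , c₂ , c₃ , d≢0 , eq) =
  d * + 2 , c₁ , c₂ , c₃ , d*2≢0 d d≢0 , trans (⊙-assoc d (+ 2) v) eq

A3-equal-norms : ∀ {Ψ} {a₁ a₂ a₃ β : Vect n} → IsA3 Ψ a₁ a₂ a₃ →
                 A3Roots a₁ a₂ a₃ β → ‖ β ‖² ≡ ‖ a₁ ‖²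
A3-equal-norms {a₁ = a₁} {a₂} {a₃} (a₁⊥a₃ , h₁ , h₂ , h₃ , h₄ , _) = norm
  where
  ‖a₂‖≡‖a₁‖ : ‖ a₂ ‖² ≡ ‖ a₁ ‖²
  ‖a₂‖≡‖a₁‖ = ℤ.neg-injective (trans (sym h₂) h₁)
  ‖a₃‖≡‖a₁‖ : ‖ a₃ ‖² ≡ ‖ a₁ ‖²
  ‖a₃‖≡‖a₁‖ = trans (ℤ.neg-injective (trans (sym h₄) h₃)) ‖a₂‖≡‖a₁‖
  a₁₂⊥a₃ : (+ 2) * ⟪ a₁ ⊕ a₂ , a₃ ⟫ ≡ - ‖ a₃ ‖²
  a₁₂⊥a₃ = begin
    (+ 2) * ⟪ a₁ ⊕ a₂ , a₃ ⟫               ≡⟨ cong ((+ 2) *_) (⟪⟫-⊕ˡ a₁ a₂ a₃) ⟩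
    (+ 2) * (⟪ a₁ , a₃ ⟫ + ⟪ a₂ , a₃ ⟫)    ≡⟨ cong (λ t → (+ 2) * (t + ⟪ a₂ , a₃ ⟫)) a₁⊥a₃ ⟩
    (+ 2) * (+ 0 + ⟪ a₂ , a₃ ⟫)            ≡⟨ cong ((+ 2) *_) (ℤ.+-identityˡ _) ⟩
    (+ 2) * ⟪ a₂ , a₃ ⟫                    ≡⟨ h₄ ⟩
    - ‖ a₃ ‖²                               ∎
    where open ≡-Reasoning
  norm : ∀ {β} → A3Roots a₁ a₂ a₃ β → ‖ β ‖² ≡ ‖ a₁ ‖²
  norm (inj₁ refl) = refl
  norm (inj₂ (inj₁ refl)) = ‖a₂‖≡‖a₁‖
  norm (inj₂ (inj₂ (inj₁ refl))) = ‖a₃‖≡‖a₁‖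
  norm (inj₂ (inj₂ (inj₂ (inj₁ refl)))) = ‖⊕‖²-reflection a₁ a₂ h₂
  norm (inj₂ (inj₂ (inj₂ (inj₂ (inj₁ refl))))) = trans (‖⊕‖²-reflection a₂ a₃ h₄) ‖a₂‖≡‖a₁‖
  norm (inj₂ (inj₂ (inj₂ (inj₂ (inj₂ refl))))) =
    trans (‖⊕‖²-reflection (a₁ ⊕ a₂) a₃ a₁₂⊥a₃) (‖⊕‖²-reflection a₁ a₂ h₂)

2x≢-1 : ∀ x → (+ 2) * x ≢ - (+ 1)
2x≢-1 x eq with ℕ.m*n≡1⇒m≡1 2 ∣ x ∣ (trans (sym (ℤ.abs-* (+ 2) x)) (cong ∣_∣ eq))
... | ()

-- in B_n an A₃ subsystem consists of long roots: their common norm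
-- ‖a₁‖² = -2⟪a₁,a₂⟫ is even, so it is not 1
A3-long : {a₁ a₂ a₃ β : Vect n} → IsA3 B a₁ a₂ a₃ →
          InSpan3 a₁ a₂ a₃ β → Pos B β → ‖ β ‖² ≡ + 2
A3-long {a₁ = a₁} {a₂} {β = β} isA@(_ , h₁ , _ , _ , _ , roots) s p with posB-norm p
... | inj₂ ‖β‖≡2 = ‖β‖≡2
... | inj₁ ‖β‖≡1 = contradiction (trans h₁ (cong -_ ‖a₁‖≡1)) (2x≢-1 ⟪ a₁ , a₂ ⟫)
  where ‖a₁‖≡1 : ‖ a₁ ‖² ≡ + 1
        ‖a₁‖≡1 = trans (sym (A3-equal-norms {Ψ = B} isA (to (roots β s) p))) ‖β‖≡1

A3-self-coroot : {a₁ a₂ a₃ β : Vect n} → IsA3 B a₁ a₂ a₃ →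
                 InSpan3 a₁ a₂ a₃ β → Pos B β ⊎ Pos C β → Coroot β β
A3-self-coroot isA s (inj₁ p) = long (A3-long isA s p) refl
A3-self-coroot isA s (inj₂ p) with posC-coroot p
... | v , pv , cr = subst (λ β → Coroot β β) (sym (coroot-unique cr v↦v)) v↦v
  where v↦v : Coroot v v
        v↦v = long (A3-long isA (coroot-span3 cr s) pv) refl

A3-pos : {a₁ a₂ a₃ β : Vect n} → IsA3 B a₁ a₂ a₃ →
         InSpan3 a₁ a₂ a₃ β → Pos B β ⇔ Pos C β
A3-pos isA s = mk⇔ (λ p → posB→posC (A3-self-coroot isA s (inj₁ p)) p)
                   (λ p → posC→posB (A3-self-coroot isA s (inj₂ p)) p)

A3-inv : (w : SignedPerm n) {a₁ a₂ a₃ β : Vect n} → IsA3 B a₁ a₂ a₃ →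
         InSpan3 a₁ a₂ a₃ β → Inv B w β ⇔ Inv C w β
A3-inv w isA s = mk⇔ (λ i → to (coroot-inv w (A3-self-coroot isA s (inj₁ (proj₁ i)))) i)
                     (λ i → from (coroot-inv w (A3-self-coroot isA s (inj₂ (proj₁ i)))) i)

A3-B→C : {a₁ a₂ a₃ : Vect n} → IsA3 B a₁ a₂ a₃ → IsA3 C a₁ a₂ a₃
A3-B→C isA@(a₁⊥a₃ , h₁ , h₂ , h₃ , h₄ , roots) =
  a₁⊥a₃ , h₁ , h₂ , h₃ , h₄ , λ β s → ⇔.trans (⇔.sym (A3-pos isA s)) (roots β s)

A3-pattern-B→C : (w : SignedPerm n) {a₁ a₂ a₃ : Vect n} (S : Vect n → Set) →
  IsA3 B a₁ a₂ a₃ → (∀ β → InSpan3 a₁ a₂ a₃ β → Inv B w β ⇔ S β) →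
  ∀ β → InSpan3 a₁ a₂ a₃ β → Inv C w β ⇔ S β
A3-pattern-B→C w S isA pat β s = ⇔.trans (⇔.sym (A3-inv w isA s)) (pat β s)

contains3142-B→C : (w : SignedPerm n) → Contains3142 w B → Contains3142 w C
contains3142-B→C w (a₁ , a₂ , a₃ , isA , pat) =
  a₁ , a₂ , a₃ , A3-B→C isA , A3-pattern-B→C w _ isA pat

contains2413-B→C : (w : SignedPerm n) → Contains2413 w B → Contains2413 w C
contains2413-B→C w (a₁ , a₂ , a₃ , isA , pat) =
  a₁ , a₂ , a₃ , A3-B→C isA , A3-pattern-B→C w _ isA pat

data B2Index : Set where
  ρ₁ ρ₂ ρ₁₂ ρ₁₂₂ : B2Index

b2root : Vect n → Vect n → B2Index → Vect n
b2root b₁ b₂ ρ₁ = b₁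
b2root b₁ b₂ ρ₂ = b₂
b2root b₁ b₂ ρ₁₂ = b₁ ⊕ b₂
b2root b₁ b₂ ρ₁₂₂ = b₁ ⊕ (+ 2) ⊙ b₂

B2Roots : Vect n → Vect n → Vect n → Set
B2Roots b₁ b₂ β = β ≡ b₁ ⊎ β ≡ b₂ ⊎ β ≡ b₁ ⊕ b₂ ⊎ β ≡ b₁ ⊕ (+ 2) ⊙ b₂

B2Roots⇔ : {b₁ b₂ β : Vect n} → B2Roots b₁ b₂ β ⇔ (∃[ t ] β ≡ b2root b₁ b₂ t)
B2Roots⇔ {b₁ = b₁} {b₂} {β} = mk⇔ index enumerate
  where
  index : B2Roots b₁ b₂ β → ∃[ t ] β ≡ b2root b₁ b₂ t
  index (inj₁ eq) = ρ₁ , eq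
  index (inj₂ (inj₁ eq)) = ρ₂ , eq
  index (inj₂ (inj₂ (inj₁ eq))) = ρ₁₂ , eq
  index (inj₂ (inj₂ (inj₂ eq))) = ρ₁₂₂ , eq
  enumerate : ∃[ t ] β ≡ b2root b₁ b₂ t → B2Roots b₁ b₂ β
  enumerate (ρ₁ , eq) = inj₁ eq
  enumerate (ρ₂ , eq) = inj₂ (inj₁ eq)
  enumerate (ρ₁₂ , eq) = inj₂ (inj₂ (inj₁ eq))
  enumerate (ρ₁₂₂ , eq) = inj₂ (inj₂ (inj₂ eq))

b2root-span : (b₁ b₂ : Vect n) (t : B2Index) → InSpan2 b₁ b₂ (b2root b₁ b₂ t)
b2root-span b₁ b₂ ρ₁ = + 1 , + 1 , + 0 , (λ ()) , sym (⊕-zero-multipleʳ ((+ 1) ⊙ b₁) b₂)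
b2root-span b₁ b₂ ρ₂ = + 1 , + 0 , + 1 , (λ ()) , sym (⊕-zero-multipleˡ b₁ ((+ 1) ⊙ b₂))
b2root-span b₁ b₂ ρ₁₂ = + 1 , + 1 , + 1 , (λ ()) , ⊙-distrib-⊕ (+ 1) b₁ b₂
b2root-span b₁ b₂ ρ₁₂₂ = + 1 , + 1 , + 2 , (λ ()) ,
  trans (⊙-distrib-⊕ (+ 1) b₁ ((+ 2) ⊙ b₂)) (cong ((+ 1) ⊙ b₁ ⊕_) (⊙-identity ((+ 2) ⊙ b₂)))

-- taking coroots exchanges long and short roots: b₁ ↔ b₂, b₁+b₂ ↔ b₁+2b₂
dual : B2Index → B2Index
dual ρ₁ = ρ₂
dual ρ₂ = ρ₁
dual ρ₁₂ = ρ₁₂₂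
dual ρ₁₂₂ = ρ₁₂

dual-involutive : ∀ t → dual (dual t) ≡ t
dual-involutive ρ₁ = refl
dual-involutive ρ₂ = refl
dual-involutive ρ₁₂ = refl
dual-involutive ρ₁₂₂ = refl

-- A B₂ subsystem of B_n with simple roots b₁ (long), b₂ (short), and the
-- dual B₂ subsystem of C_n with simple roots b₁ᶜ = 2b₂ (long), b₂ᶜ = b₁.
module DualB2 {n} (b₁ b₂ : Vect n) (isB : IsB2 B b₁ b₂) where

  b₁ᶜ b₂ᶜ : Vect n
  b₁ᶜ = (+ 2) ⊙ b₂
  b₂ᶜ = b₁

  rootB : B2Index → Vect n
  rootB = b2root b₁ b₂

  -- the coroot of rootB t, listed among the roots of the dual subsystem
  rootC : B2Index → Vect n
  rootC t = b2root b₁ᶜ b₂ᶜ (dual t)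

  posB-roots : {β : Vect n} → InSpan2 b₁ b₂ β → Pos B β ⇔ (∃[ t ] β ≡ rootB t)
  posB-roots {β} s = ⇔.trans (proj₂ (proj₂ isB) β s) B2Roots⇔

  rootB-pos : ∀ t → Pos B (rootB t)
  rootB-pos t = from (posB-roots (b2root-span b₁ b₂ t)) (t , refl)

  norm-ratio : {x y : ℤ} → ‖ b₁ ‖² ≡ x → ‖ b₂ ‖² ≡ y → x ≡ (+ 2) * y
  norm-ratio p q = trans (sym p) (trans (proj₁ isB) (cong ((+ 2) *_) q))

  -- b₁, b₂ are roots of norm 1 or 2 with ‖b₁‖² = 2‖b₂‖²
  simple-norms : ‖ b₁ ‖² ≡ + 2 × ‖ b₂ ‖² ≡ + 1
  simple-norms with posB-norm (rootB-pos ρ₁) | posB-norm (rootB-pos ρ₂)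
  ... | inj₂ n₁ | inj₁ n₂ = n₁ , n₂
  ... | inj₁ n₁ | inj₁ n₂ = contradiction (norm-ratio n₁ n₂) λ ()
  ... | inj₁ n₁ | inj₂ n₂ = contradiction (norm-ratio n₁ n₂) λ ()
  ... | inj₂ n₁ | inj₂ n₂ = contradiction (norm-ratio n₁ n₂) λ ()

  ‖b₁‖≡2 : ‖ b₁ ‖² ≡ + 2
  ‖b₁‖≡2 = proj₁ simple-norms

  ‖b₂‖≡1 : ‖ b₂ ‖² ≡ + 1
  ‖b₂‖≡1 = proj₂ simple-norms

  ⟪b₁,b₂⟫≡-1 : ⟪ b₁ , b₂ ⟫ ≡ - (+ 1)
  ⟪b₁,b₂⟫≡-1 = trans (proj₁ (proj₂ isB)) (cong -_ ‖b₂‖≡1)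

  ‖b₁+b₂‖≡1 : ‖ b₁ ⊕ b₂ ‖² ≡ + 1
  ‖b₁+b₂‖≡1 rewrite ‖⊕‖² b₁ b₂ | ‖b₁‖≡2 | ‖b₂‖≡1 | ⟪b₁,b₂⟫≡-1 = refl

  ‖b₁+2b₂‖≡2 : ‖ b₁ ⊕ (+ 2) ⊙ b₂ ‖² ≡ + 2
  ‖b₁+2b₂‖≡2 rewrite ‖⊕‖² b₁ ((+ 2) ⊙ b₂) | ⟪⟫-⊙ʳ (+ 2) b₂ b₁ | ‖⊙‖² (+ 2) b₂
                   | ‖b₁‖≡2 | ‖b₂‖≡1 | ⟪b₁,b₂⟫≡-1 = refl

  coroots : ∀ t → Coroot (rootB t) (rootC t)
  coroots ρ₁ = long ‖b₁‖≡2 refl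
  coroots ρ₂ = short ‖b₂‖≡1 refl
  coroots ρ₁₂ = short ‖b₁+b₂‖≡1 (trans (⊕-comm b₁ᶜ _) (sym (⊙-distrib-⊕ (+ 2) b₁ b₂)))
  coroots ρ₁₂₂ = long ‖b₁+2b₂‖≡2 (⊕-comm b₁ᶜ b₂ᶜ)

  span-dual : {β : Vect n} → InSpan2 b₁ᶜ b₂ᶜ β → InSpan2 b₁ b₂ β
  span-dual (d , c₁ , c₂ , d≢0 , eq) = d , c₂ , c₁ * + 2 , d≢0 ,
    trans eq (trans (cong (_⊕ c₂ ⊙ b₁) (sym (⊙-assoc c₁ (+ 2) b₂))) (⊕-comm _ _))

  posC-in-plane : {u : Vect n} → InSpan2 b₁ᶜ b₂ᶜ u → Pos C u → ∃[ t ] u ≡ rootC t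
  posC-in-plane s p with posC-coroot p
  ... | v , pv , cr with to (posB-roots (coroot-span2 cr (span-dual s))) pv
  ... | t , refl = t , coroot-unique cr (coroots t)

  rootC-pos : ∀ t → Pos C (rootC t)
  rootC-pos t = posB→posC (coroots t) (rootB-pos t)

  isB2C : IsB2 C b₁ᶜ b₂ᶜ
  isB2C = norms , inner , λ β s → ⇔.trans (posC-roots s) (⇔.sym B2Roots⇔)
    where
    norms : ‖ b₁ᶜ ‖² ≡ (+ 2) * ‖ b₂ᶜ ‖²
    norms rewrite ‖⊙‖² (+ 2) b₂ | ‖b₁‖≡2 | ‖b₂‖≡1 = refl
    inner : ⟪ b₁ᶜ , b₂ᶜ ⟫ ≡ - ‖ b₂ᶜ ‖²
    inner rewrite ⟪⟫-⊙ˡ (+ 2) b₂ b₁ | ⟪⟫-comm b₂ b₁ | ⟪b₁,b₂⟫≡-1 | ‖b₁‖≡2 = refl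
    posC-roots : {β : Vect n} → InSpan2 b₁ᶜ b₂ᶜ β → Pos C β ⇔ (∃[ t ] β ≡ b2root b₁ᶜ b₂ᶜ t)
    posC-roots s = mk⇔
      (λ p → let (t , eq) = posC-in-plane s p in dual t , eq)
      (λ (t , eq) → subst (Pos C) (sym eq)
         (subst (Pos C ∘ b2root b₁ᶜ b₂ᶜ) (dual-involutive t) (rootC-pos (dual t))))

  pair-B→C : (w : SignedPerm n) (r s : B2Index) →
    (∀ β → InSpan2 b₁ b₂ β → Inv B w β ⇔ (β ≡ rootB r ⊎ β ≡ rootB s)) →
    ∀ β → InSpan2 b₁ᶜ b₂ᶜ β → Inv C w β ⇔ (β ≡ rootC r ⊎ β ≡ rootC s)
  pair-B→C w r s pat β β∈plane = mk⇔ (forward β∈plane) backward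
    where
    same-coroot : ∀ {t t′} → rootB t ≡ rootB t′ → rootC t ≡ rootC t′
    same-coroot {t} {t′} eq = coroot-unique (subst (λ v → Coroot v (rootC t)) eq (coroots t)) (coroots t′)
    forward : {γ : Vect n} → InSpan2 b₁ᶜ b₂ᶜ γ → Inv C w γ → γ ≡ rootC r ⊎ γ ≡ rootC s
    forward γ∈plane i with posC-in-plane γ∈plane (proj₁ i)
    ... | t , refl = Sum.map (same-coroot {t} {r}) (same-coroot {t} {s})
          (to (pat (rootB t) (b2root-span b₁ b₂ t)) (from (coroot-inv w (coroots t)) i))
    inverted : ∀ t → rootB t ≡ rootB r ⊎ rootB t ≡ rootB s → Inv C w (rootC t)
    inverted t m = to (coroot-inv w (coroots t)) (from (pat (rootB t) (b2root-span b₁ b₂ t)) m)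
    backward : β ≡ rootC r ⊎ β ≡ rootC s → Inv C w β
    backward (inj₁ eq) = subst (Inv C w) (sym eq) (inverted r (inj₁ refl))
    backward (inj₂ eq) = subst (Inv C w) (sym eq) (inverted s (inj₂ refl))

-- the two length-two B₂ patterns are exchanged by passing to the dual subsystem
containsB2-B→C : (w : SignedPerm n) → ContainsB2len2 w B → ContainsB2len2 w C
containsB2-B→C w (b₁ , b₂ , isB , inj₁ pat) =
  let open DualB2 b₁ b₂ isB in b₁ᶜ , b₂ᶜ , isB2C , inj₂ (pair-B→C w ρ₁ ρ₁₂ pat)
containsB2-B→C w (b₁ , b₂ , isB , inj₂ pat) =
  let open DualB2 b₁ b₂ isB in b₁ᶜ , b₂ᶜ , isB2C , inj₁ (pair-B→C w ρ₂ ρ₁₂₂ pat)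

lemma6p9 : (n : ℕ) (w : SignedPerm n) → AvoidsAll w C → AvoidsAll w B
lemma6p9 n w (avoids3142 , avoids2413 , avoidsB2) =
  avoids3142 ∘ contains3142-B→C w ,
  avoids2413 ∘ contains2413-B→C w ,
  avoidsB2 ∘ containsB2-B→C w
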